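{- Let $n \ge 3$, let $G=K_n$ be the complete graph of order $n$, and let $f_0: V(G_1) \rightarrow V(G_2)$ be a constant function. Then $\dim(C(K_n, f_0)) = 2n-3$.
   Context: For a connected graph $H$, a set $S \subseteq V(H)$ is a resolving set if for every two distinct vertices $x,y$ of $H$ there is $s \in S$ with $d_H(x,s) \neq d_H(y,s)$; the metric dimension $\dim(H)$ is the minimum cardinality of a resolving set of $H$. Given a graph $G$, let $G_1$ and $G_2$ be disjoint copies of $G$ and let $f: V(G_1)\to V(G_2)$ be a function. The functigraph $C(G,f)$ is the graph with vertex set $V(G_1)\cup V(G_2)$ and edge set $E(G_1)\cup E(G_2)\cup\{uv \mid u \in V(G_1),\ v=f(u)\}$. -}

module Defs where

open import Data.Nat using (ℕ; zero; suc; _≤_)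
open import Data.Fin using (Fin)
open import Data.Sum using (_⊎_; inj₁; inj₂)
open import Data.Product using (_×_; ∃; ∃-syntax; Σ-syntax)
open import Data.Empty using (⊥)
open import Data.List using (List; length)
open import Data.List.Membership.Propositional using (_∈_)
open import Data.List.Relation.Unary.Unique.Propositional using (Unique)
open import Relation.Nullary using (¬_)
open import Relation.Binary.PropositionalEquality using (_≡_; _≢_)

Graph : Set → Set₁
Graph V = V → V → Set

data Walk {V : Set} (G : Graph V) : V → V → ℕ → Set where
  here : ∀ {x} → Walk G x x zero
  step : ∀ {x y z k} → G x y → Walk G y z k → Walk G x z (suc k)

Dist : {V : Set} → Graph V → V → V → ℕ → Set
Dist G x y k = Walk G x y k × (∀ j → Walk G x y j → k ≤ j)

Connected : {V : Set} → Graph V → Set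
Connected G = ∀ x y → ∃[ k ] Walk G x y k

Resolving : {V : Set} → Graph V → List V → Set
Resolving G S = ∀ x y → x ≢ y →
  ∃[ s ] (s ∈ S × ∃[ a ] ∃[ b ] (Dist G x s a × Dist G y s b × a ≢ b))

MetricDim : {V : Set} → Graph V → ℕ → Set
MetricDim G k =
  (∃[ S ] (Unique S × length S ≡ k × Resolving G S)) ×
  (∀ S → Unique S → Resolving G S → k ≤ length S)

K : (n : ℕ) → Graph (Fin n)
K n a b = a ≢ b

-- Functigraph C(G,f): vertices V(G₁) = inj₁, V(G₂) = inj₂.
Functigraph : {V : Set} → Graph V → (V → V) → Graph (V ⊎ V)
Functigraph G f (inj₁ a) (inj₁ b) = G a b
Functigraph G f (inj₂ a) (inj₂ b) = G a b
Functigraph G f (inj₁ u) (inj₂ v) = f u ≡ v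
Functigraph G f (inj₂ v) (inj₁ u) = f u ≡ v

IsConstant : {A B : Set} → (A → B) → Set
IsConstant f = ∀ x y → f x ≡ f y

module Submission where

-- If an edge-preserving map σ swaps x and y and fixes every other
-- vertex, then x and y have the same distance to every other vertex, so a resolving set
-- contains at least one of them. Transpositions of the first copy G₁, and transpositions
-- of the second copy G₂ that fix c, are such maps. Hence a resolving set misses at most
-- one of the n vertices of G₁ and at most one of the n - 1 vertices of G₂ other than c,
-- so it has at least (n - 1) + (n - 2) = 2n - 3 elements.
--
-- Let c' ≠ c'' be two vertices of G₂ other than c. All vertices except
-- x₀ = (1,0), y₀ = (2,c), z₀ = (2,c') form a resolving set of size 2n - 3: a member of the
-- set distinguishes itself from any other vertex (distance 0), and the three outsiders are
-- pairwise distinguished by (1,1) (distances 1, 1, 2) or by (2,c'') (distances 2, 1).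

open import Defs
open import Data.Nat using (ℕ; _≤_; _∸_; _*_)
open import Data.Fin using (Fin)

open import Function using (_∘_; id)
open import Data.Nat using (zero; suc; _+_; z≤n; s≤s; s≤s⁻¹)
open import Data.Nat.Properties using (≤-antisym; ≤-reflexive; +-mono-≤; +-identityʳ; +-suc; module ≤-Reasoning)
open import Data.Fin using (zero; suc; _≟_; punchIn; punchOut)
open import Data.Fin.Properties using (suc-injective; punchIn-injective; punchInᵢ≢i; punchIn-punchOut)
open import Data.Fin.Permutation.Components using (transpose; transpose-inverse)
open import Data.Sum using (_⊎_; inj₁; inj₂; map₁; map₂)
open import Data.Sum.Properties using (inj₁-injective; inj₂-injective; ≡-dec)
open import Data.Product using (_×_; _,_; proj₂; ∃-syntax)
open import Data.Empty using (⊥; ⊥-elim)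
open import Data.List using (List; []; _∷_; _++_; length; map; filter; allFin)
open import Data.List.Properties using (length-map; length-++; length-tabulate; filter-all; filter-++)
open import Data.List.Relation.Unary.All using (All)
import Data.List.Relation.Unary.All as All
import Data.List.Relation.Unary.All.Properties as All
open import Data.List.Relation.Unary.Any using (here; there)
open import Data.List.Relation.Unary.AllPairs using (_∷_)
open import Data.List.Relation.Unary.Unique.Propositional using (Unique)
import Data.List.Relation.Unary.Unique.Propositional.Properties as Unique
open import Data.List.Membership.Propositional using (_∈_; _∉_)
open import Data.List.Membership.Propositional.Properties
  using (∈-map⁺; ∈-map⁻; ∈-++⁺ˡ; ∈-++⁺ʳ; ∈-++⁻; ∈-∃++; ∈-filter⁻; ∈-allFin)
import Data.List.Membership.DecPropositional as DecMembership
open import Relation.Nullary using (¬_; yes; no)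
open import Relation.Nullary.Decidable using (dec-true; dec-false; decidable-stable)
open import Relation.Binary.Definitions using (DecidableEquality)
open import Relation.Binary.PropositionalEquality using (_≡_; _≢_; refl; sym; trans; cong; cong₂; subst; subst₂; module ≡-Reasoning)

record Swaps {V : Set} (σ : V → V) (x y : V) : Set where
  field
    sends-x      : σ x ≡ y
    sends-y      : σ y ≡ x
    fixes-others : ∀ s → s ≢ x → s ≢ y → σ s ≡ s

open Swaps

module _ {V : Set} (G : Graph V) where

  dist-unique : ∀ {x y a b} → Dist G x y a → Dist G x y b → a ≡ b
  dist-unique (wa , shortest-a) (wb , shortest-b) = ≤-antisym (shortest-a _ wb) (shortest-b _ wa)

  walk-zero : ∀ {x y} → Walk G x y 0 → x ≡ y
  walk-zero here = refl

  dist-zero : ∀ {x y} → Dist G x y 0 → x ≡ y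
  dist-zero (w , _) = walk-zero w

  dist-self : ∀ x → Dist G x x 0
  dist-self x = here , λ _ _ → z≤n

  dist-adjacent : ∀ {x y} → G x y → x ≢ y → Dist G x y 1
  dist-adjacent {x} {y} xy x≢y = step xy here , shortest
    where
    shortest : ∀ j → Walk G x y j → 1 ≤ j
    shortest zero    w = ⊥-elim (x≢y (walk-zero w))
    shortest (suc j) _ = s≤s z≤n

  dist-two : ∀ {x y z} → ¬ G x y → x ≢ y → G x z → G z y → Dist G x y 2
  dist-two {x} {y} ¬xy x≢y xz zy = step xz (step zy here) , shortest
    where
    shortest : ∀ j → Walk G x y j → 2 ≤ j
    shortest zero          w                 = ⊥-elim (x≢y (walk-zero w))
    shortest (suc zero)    (step xy here)    = ⊥-elim (¬xy xy)
    shortest (suc (suc j)) _                 = s≤s (s≤s z≤n)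

  Distinguished : List V → V → V → Set
  Distinguished S x y = ∃[ s ] (s ∈ S × ∃[ a ] ∃[ b ] (Dist G x s a × Dist G y s b × a ≢ b))

  distinguished-sym : ∀ {S x y} → Distinguished S x y → Distinguished S y x
  distinguished-sym (s , s∈S , a , b , dx , dy , a≢b) = s , s∈S , b , a , dy , dx , a≢b ∘ sym

  member-distinguishes : ∀ {S x y k} → x ∈ S → Dist G y x k → x ≢ y → Distinguished S x y
  member-distinguishes {x = x} {y} x∈S dyx x≢y =
    x , x∈S , 0 , _ , dist-self x , dyx ,
    λ 0≡k → x≢y (sym (dist-zero (subst (Dist G y x) (sym 0≡k) dyx)))

  resolving-from-outsiders : (∀ x y → ∃[ k ] Dist G x y k) → (S O : List V) →
    (∀ v → v ∈ S ⊎ v ∈ O) →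
    (∀ {x y} → x ∈ O → y ∈ O → x ≢ y → Distinguished S x y) →
    Resolving G S
  resolving-from-outsiders dist S O cover separates x y x≢y with cover x | cover y
  ... | inj₁ x∈S | _        = member-distinguishes x∈S (proj₂ (dist y x)) x≢y
  ... | inj₂ _   | inj₁ y∈S = distinguished-sym (member-distinguishes y∈S (proj₂ (dist x y)) (x≢y ∘ sym))
  ... | inj₂ x∈O | inj₂ y∈O = separates x∈O y∈O x≢y

  Hom : (V → V) → Set
  Hom σ = ∀ u v → G u v → G (σ u) (σ v)

  map-walk : ∀ {σ} → Hom σ → ∀ {x y k} → Walk G x y k → Walk G (σ x) (σ y) k
  map-walk hom here       = here
  map-walk hom (step e w) = step (hom _ _ e) (map-walk hom w)

  -- An edge-preserving swap of x and y carries shortest walks from x to a fixed vertex s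
  -- onto walks from y to s, and vice versa; so x and y are equally far from s.
  swap-preserves-dist : ∀ {σ x y s k} → Hom σ → Swaps σ x y → s ≢ x → s ≢ y →
    Dist G x s k → Dist G y s k
  swap-preserves-dist {σ} {s = s} hom sw s≢x s≢y (w , shortest) =
    move (sends-x sw) (map-walk hom w) , λ j w′ → shortest j (move (sends-y sw) (map-walk hom w′))
    where
    move : ∀ {u v j} → σ u ≡ v → Walk G (σ u) (σ s) j → Walk G v s j
    move {j = j} σu≡v = subst₂ (λ a b → Walk G a b j) σu≡v (fixes-others sw s s≢x s≢y)

  swappable-not-both-outside : ∀ {S σ x y} → Resolving G S → Hom σ → Swaps σ x y → x ≢ y →
    x ∉ S → y ∉ S → ⊥
  swappable-not-both-outside {S} res hom sw x≢y x∉S y∉S with res _ _ x≢y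
  ... | s , s∈S , a , b , dxs , dys , a≢b =
    a≢b (dist-unique (swap-preserves-dist hom sw (outside x∉S) (outside y∉S) dxs) dys)
    where
    outside : ∀ {v} → v ∉ S → s ≢ v
    outside v∉S s≡v = v∉S (subst (_∈ S) s≡v s∈S)

unique-⊆-length : ∀ {A : Set} {T S : List A} → Unique T → (∀ {x} → x ∈ T → x ∈ S) →
  length T ≤ length S
unique-⊆-length {T = []}    _            _    = z≤n
unique-⊆-length {T = x ∷ T} (x∉T ∷ uniq) T⊆S with ∈-∃++ (T⊆S (here refl))
... | ys , zs , refl = begin
    suc (length T)               ≤⟨ s≤s (unique-⊆-length uniq T⊆ys++zs) ⟩
    suc (length (ys ++ zs))      ≡⟨ cong suc (length-++ ys) ⟩
    suc (length ys + length zs)  ≡⟨ sym (+-suc (length ys) (length zs)) ⟩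
    length ys + suc (length zs)  ≡⟨ sym (length-++ ys) ⟩
    length (ys ++ x ∷ zs)        ∎
  where
  open ≤-Reasoning
  T⊆ys++zs : ∀ {y} → y ∈ T → y ∈ ys ++ zs
  T⊆ys++zs y∈T with ∈-++⁻ ys (T⊆S (there y∈T))
  ... | inj₁ y∈ys          = ∈-++⁺ˡ y∈ys
  ... | inj₂ (here y≡x)    = ⊥-elim (All.lookup x∉T y∈T (sym y≡x))
  ... | inj₂ (there y∈zs)  = ∈-++⁺ʳ ys y∈zs

module _ {A V : Set} (_≟V_ : DecidableEquality V) where
  open DecMembership _≟V_ using (_∈?_)

  outside-at-most-one : ∀ (S : List V) (g : A → V) xs → Unique xs →
    (∀ {i j} → i ≢ j → g i ∉ S → g j ∉ S → ⊥) →
    length xs ≤ suc (length (filter (_∈? S) (map g xs)))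
  outside-at-most-one S g []       _            _     = z≤n
  outside-at-most-one S g (i ∷ xs) (i∉xs ∷ uniq) twins with g i ∈? S
  ... | yes _    = s≤s (outside-at-most-one S g xs uniq twins)
  ... | no gi∉S  = s≤s (≤-reflexive (sym (begin
    length (filter (_∈? S) (map g xs))  ≡⟨ cong length (filter-all (_∈? S) (All.map⁺ rest-inside)) ⟩
    length (map g xs)                   ≡⟨ length-map g xs ⟩
    length xs                           ∎)))
    where
    open ≡-Reasoning
    rest-inside : All (λ j → g j ∈ S) xs
    rest-inside = All.map (λ i≢j → decidable-stable (_ ∈? S) (twins i≢j gi∉S)) i∉xs

tagged-disjoint : ∀ {A B C D : Set} (g : A → C) (h : B → D) (xs : List A) (ys : List B) →
  ∀ {v} → ¬ (v ∈ map (inj₁ ∘ g) xs × v ∈ map (inj₂ ∘ h) ys)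
tagged-disjoint g h xs ys (p , q) with ∈-map⁻ _ p | ∈-map⁻ _ q
... | _ , _ , refl | _ , _ , ()

length-map-allFin : ∀ {A : Set} k (g : Fin k → A) → length (map g (allFin k)) ≡ k
length-map-allFin k g = trans (length-map g (allFin k)) (length-tabulate {n = k} id)

transpose-swaps : ∀ {n} (a b : Fin n) → Swaps (transpose a b) a b
transpose-swaps a b = record { sends-x = sends-a ; sends-y = sends-b ; fixes-others = fixes }
  where
  sends-a : transpose a b a ≡ b
  sends-a rewrite dec-true (a ≟ a) refl = refl
  sends-b : transpose a b b ≡ a
  sends-b with b ≟ a
  ... | yes refl = refl
  ... | no _ rewrite dec-true (b ≟ b) refl = refl
  fixes : ∀ k → k ≢ a → k ≢ b → transpose a b k ≡ k
  fixes k k≢a k≢b rewrite dec-false (k ≟ a) k≢a | dec-false (k ≟ b) k≢b = refl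

transpose-injective : ∀ {n} (a b : Fin n) {u v} → transpose a b u ≡ transpose a b v → u ≡ v
transpose-injective a b eq =
  trans (sym (transpose-inverse b a)) (trans (cong (transpose b a) eq) (transpose-inverse b a))

map₁-swaps : ∀ {A B : Set} {π : A → A} {a b} → Swaps π a b → Swaps (map₁ {B = B} π) (inj₁ a) (inj₁ b)
map₁-swaps sw = record
  { sends-x = cong inj₁ (sends-x sw) ; sends-y = cong inj₁ (sends-y sw) ; fixes-others = fixes }
  where
  fixes : ∀ s → s ≢ inj₁ _ → s ≢ inj₁ _ → map₁ _ s ≡ s
  fixes (inj₁ k) k≢a k≢b = cong inj₁ (fixes-others sw k (k≢a ∘ cong inj₁) (k≢b ∘ cong inj₁))
  fixes (inj₂ k) _   _   = refl

map₂-swaps : ∀ {A B : Set} {π : B → B} {a b} → Swaps π a b → Swaps (map₂ {A = A} π) (inj₂ a) (inj₂ b)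
map₂-swaps sw = record
  { sends-x = cong inj₂ (sends-x sw) ; sends-y = cong inj₂ (sends-y sw) ; fixes-others = fixes }
  where
  fixes : ∀ s → s ≢ inj₂ _ → s ≢ inj₂ _ → map₂ _ s ≡ s
  fixes (inj₁ k) _   _   = refl
  fixes (inj₂ k) k≢a k≢b = cong inj₂ (fixes-others sw k (k≢a ∘ cong inj₂) (k≢b ∘ cong inj₂))

module _ {V : Set} {G : Graph V} {f : V → V} where

  lift₁-hom : ∀ {π} → Hom G π → (∀ u → f (π u) ≡ f u) → Hom (Functigraph G f) (map₁ π)
  lift₁-hom hom fπ≡f (inj₁ u) (inj₁ v) e = hom u v e
  lift₁-hom hom fπ≡f (inj₂ u) (inj₂ v) e = e
  lift₁-hom hom fπ≡f (inj₁ u) (inj₂ v) e = trans (fπ≡f u) e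
  lift₁-hom hom fπ≡f (inj₂ v) (inj₁ u) e = trans (fπ≡f u) e

  lift₂-hom : ∀ {π} → Hom G π → (∀ u → π (f u) ≡ f u) → Hom (Functigraph G f) (map₂ π)
  lift₂-hom hom πf≡f (inj₁ u) (inj₁ v) e = e
  lift₂-hom hom πf≡f (inj₂ u) (inj₂ v) e = hom u v e
  lift₂-hom {π} hom πf≡f (inj₁ u) (inj₂ v) e = trans (sym (πf≡f u)) (cong π e)
  lift₂-hom {π} hom πf≡f (inj₂ v) (inj₁ u) e = trans (sym (πf≡f u)) (cong π e)

injective-hom-K : ∀ {n} {π : Fin n → Fin n} → (∀ {u v} → π u ≡ π v → u ≡ v) → Hom (K n) π
injective-hom-K inj u v u≢v πu≡πv = u≢v (inj πu≡πv)

functigraph-K-distances : ∀ {n} (f : Fin n → Fin n) x y → ∃[ k ] Dist (Functigraph (K n) f) x y k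
functigraph-K-distances f (inj₁ a) (inj₁ b) with a ≟ b
... | yes refl = 0 , dist-self _ _
... | no a≢b   = 1 , dist-adjacent _ a≢b (a≢b ∘ inj₁-injective)
functigraph-K-distances f (inj₂ a) (inj₂ b) with a ≟ b
... | yes refl = 0 , dist-self _ _
... | no a≢b   = 1 , dist-adjacent _ a≢b (a≢b ∘ inj₂-injective)
functigraph-K-distances f (inj₁ a) (inj₂ b) with f a ≟ b
... | yes fa≡b = 1 , dist-adjacent _ fa≡b (λ ())
... | no fa≢b  = 2 , dist-two _ {z = inj₂ (f a)} fa≢b (λ ()) refl fa≢b
functigraph-K-distances f (inj₂ b) (inj₁ a) with f a ≟ b
... | yes fa≡b = 1 , dist-adjacent _ fa≡b (λ ())
... | no fa≢b  = 2 , dist-two _ {z = inj₂ (f a)} fa≢b (λ ()) (fa≢b ∘ sym) refl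

double-minus-three : ∀ m → 2 * suc (suc (suc m)) ∸ 3 ≡ suc (suc m) + suc m
double-minus-three m = begin
  m + suc (suc (suc (m + 0)))  ≡⟨ cong (λ t → m + suc (suc (suc t))) (+-identityʳ m) ⟩
  m + suc (suc (suc m))        ≡⟨ +-suc m (suc (suc m)) ⟩
  suc (m + suc (suc m))        ≡⟨ cong suc (+-suc m (suc m)) ⟩
  suc (suc (m + suc m))        ∎
  where open ≡-Reasoning

module ConstantFunctigraph (m : ℕ) (f : Fin (suc (suc (suc m))) → Fin (suc (suc (suc m))))
                           (f-const : IsConstant f) where

  n : ℕ
  n = suc (suc (suc m))

  V : Set
  V = Fin n ⊎ Fin n

  H : Graph V
  H = Functigraph (K n) f

  c : Fin n
  c = f zero

  f≡c : ∀ u → f u ≡ c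
  f≡c u = f-const u zero

  _≟V_ : DecidableEquality V
  _≟V_ = ≡-dec _≟_ _≟_

  open DecMembership _≟V_ using (_∈?_)

  -- Any two vertices of the first copy are swappable, since f is constant.
  copy₁-twins : ∀ {S} → Resolving H S → ∀ {a b} → a ≢ b → inj₁ a ∉ S → inj₁ b ∉ S → ⊥
  copy₁-twins res {a} {b} a≢b =
    swappable-not-both-outside H res
      (lift₁-hom (injective-hom-K (transpose-injective a b)) (λ u → f-const _ u))
      (map₁-swaps (transpose-swaps a b)) (a≢b ∘ inj₁-injective)

  -- Any two vertices of the second copy other than c are swappable: their transposition fixes c.
  copy₂-twins : ∀ {S} → Resolving H S → ∀ {i j} → i ≢ j →
    inj₂ (punchIn c i) ∉ S → inj₂ (punchIn c j) ∉ S → ⊥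
  copy₂-twins res {i} {j} i≢j =
    swappable-not-both-outside H res
      (lift₂-hom (injective-hom-K (transpose-injective a b)) fixes-image)
      (map₂-swaps (transpose-swaps a b)) (i≢j ∘ punchIn-injective c i j ∘ inj₂-injective)
    where
    a b : Fin n
    a = punchIn c i
    b = punchIn c j
    fixes-image : ∀ u → transpose a b (f u) ≡ f u
    fixes-image u = subst (λ t → transpose a b t ≡ t) (sym (f≡c u))
      (fixes-others (transpose-swaps a b) c (punchInᵢ≢i c i ∘ sym) (punchInᵢ≢i c j ∘ sym))

  lower-bound : ∀ S → Unique S → Resolving H S → 2 * n ∸ 3 ≤ length S
  lower-bound S _ res = begin
    2 * n ∸ 3                          ≡⟨ double-minus-three m ⟩
    suc (suc m) + suc m                ≤⟨ +-mono-≤ (s≤s⁻¹ in-copy₁) (s≤s⁻¹ in-copy₂) ⟩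
    length F₁ + length F₂              ≡⟨ sym (length-++ F₁) ⟩
    length (F₁ ++ F₂)                  ≡⟨ cong length (sym (filter-++ (_∈? S) E₁ E₂)) ⟩
    length (filter (_∈? S) (E₁ ++ E₂)) ≤⟨ unique-⊆-length (Unique.filter⁺ (_∈? S) E-unique)
                                                          (proj₂ ∘ ∈-filter⁻ (_∈? S)) ⟩
    length S                           ∎
    where
    open ≤-Reasoning
    E₁ E₂ F₁ F₂ : List V
    E₁ = map inj₁ (allFin n)
    E₂ = map (inj₂ ∘ punchIn c) (allFin (suc (suc m)))
    F₁ = filter (_∈? S) E₁
    F₂ = filter (_∈? S) E₂
    E-unique : Unique (E₁ ++ E₂)
    E-unique = Unique.++⁺ (Unique.map⁺ inj₁-injective (Unique.allFin⁺ n))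
      (Unique.map⁺ (λ e → punchIn-injective c _ _ (inj₂-injective e)) (Unique.allFin⁺ _))
      (tagged-disjoint id (punchIn c) _ _)
    in-copy₁ : suc (suc (suc m)) ≤ suc (length F₁)
    in-copy₁ = subst (_≤ suc (length F₁)) (length-tabulate {n = n} id)
      (outside-at-most-one _≟V_ S inj₁ (allFin n) (Unique.allFin⁺ n) (copy₁-twins res))
    in-copy₂ : suc (suc m) ≤ suc (length F₂)
    in-copy₂ = subst (_≤ suc (length F₂)) (length-tabulate {n = suc (suc m)} id)
      (outside-at-most-one _≟V_ S (inj₂ ∘ punchIn c) (allFin _) (Unique.allFin⁺ _) (copy₂-twins res))

  -- The three vertices left out of the basis; z₀ is (2,c') with c' = punchIn c 0 ≠ c.
  x₀ y₀ z₀ : V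
  x₀ = inj₁ zero
  y₀ = inj₂ c
  z₀ = inj₂ (punchIn c zero)

  outsiders : List V
  outsiders = x₀ ∷ y₀ ∷ z₀ ∷ []

  -- All other vertices: G₁ minus 0, and G₂ minus c and c'.
  basis₁ basis₂ basis : List V
  basis₁ = map (inj₁ ∘ suc) (allFin (suc (suc m)))
  basis₂ = map (inj₂ ∘ punchIn c ∘ suc) (allFin (suc m))
  basis  = basis₁ ++ basis₂

  basis-unique : Unique basis
  basis-unique = Unique.++⁺
    (Unique.map⁺ (λ e → suc-injective (inj₁-injective e)) (Unique.allFin⁺ _))
    (Unique.map⁺ (λ e → suc-injective (punchIn-injective c _ _ (inj₂-injective e))) (Unique.allFin⁺ _))
    (tagged-disjoint suc (punchIn c ∘ suc) _ _)

  basis-length : length basis ≡ 2 * n ∸ 3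
  basis-length = begin
    length (basis₁ ++ basis₂)          ≡⟨ length-++ basis₁ ⟩
    length basis₁ + length basis₂      ≡⟨ cong₂ _+_ (length-map-allFin (suc (suc m)) (inj₁ ∘ suc))
                                           (length-map-allFin (suc m) (inj₂ ∘ punchIn c ∘ suc)) ⟩
    suc (suc m) + suc m                ≡⟨ sym (double-minus-three m) ⟩
    2 * n ∸ 3                          ∎
    where open ≡-Reasoning

  cover : ∀ v → v ∈ basis ⊎ v ∈ outsiders
  cover (inj₁ zero)    = inj₂ (here refl)
  cover (inj₁ (suc k)) = inj₁ (∈-++⁺ˡ (∈-map⁺ (inj₁ ∘ suc) (∈-allFin k)))
  cover (inj₂ b) with b ≟ c
  ... | yes refl = inj₂ (there (here refl))
  ... | no b≢c with punchOut (b≢c ∘ sym) | punchIn-punchOut (b≢c ∘ sym)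
  ...   | zero  | refl = inj₂ (there (there (here refl)))
  ...   | suc k | refl = inj₁ (∈-++⁺ʳ basis₁ (∈-map⁺ (inj₂ ∘ punchIn c ∘ suc) (∈-allFin k)))

  -- Two basis vertices that tell the outsiders apart: a₁ = (1,1) and b₁ = (2,c'').
  a₁ b₁ : V
  a₁ = inj₁ (suc zero)
  b₁ = inj₂ (punchIn c (suc zero))

  a₁∈basis : a₁ ∈ basis
  a₁∈basis = ∈-++⁺ˡ (∈-map⁺ (inj₁ ∘ suc) (∈-allFin zero))

  b₁∈basis : b₁ ∈ basis
  b₁∈basis = ∈-++⁺ʳ basis₁ (∈-map⁺ (inj₂ ∘ punchIn c ∘ suc) (∈-allFin zero))

  c≢b₁ : c ≢ punchIn c (suc zero)
  c≢b₁ = punchInᵢ≢i c (suc zero) ∘ sym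

  z₀≢c : punchIn c zero ≢ c
  z₀≢c = punchInᵢ≢i c zero

  -- z₀ reaches a₁ only through y₀.
  z₀-a₁ : Dist H z₀ a₁ 2
  z₀-a₁ = dist-two H {z = y₀} (λ e → z₀≢c (trans (sym e) (f≡c _))) (λ ()) z₀≢c (f≡c _)

  -- b₁ is adjacent to y₀ but not to x₀, whose only neighbour in G₂ is y₀.
  x₀-y₀ : Distinguished H basis x₀ y₀
  x₀-y₀ = b₁ , b₁∈basis , 2 , 1
        , dist-two H {z = y₀} c≢b₁ (λ ()) refl c≢b₁
        , dist-adjacent H c≢b₁ (c≢b₁ ∘ inj₂-injective) , λ ()

  x₀-z₀ : Distinguished H basis x₀ z₀
  x₀-z₀ = a₁ , a₁∈basis , 1 , 2 , dist-adjacent H (λ ()) (λ ()) , z₀-a₁ , λ ()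

  y₀-z₀ : Distinguished H basis y₀ z₀
  y₀-z₀ = a₁ , a₁∈basis , 1 , 2 , dist-adjacent H (f≡c _) (λ ()) , z₀-a₁ , λ ()

  separation : ∀ {x y} → x ∈ outsiders → y ∈ outsiders → x ≢ y → Distinguished H basis x y
  separation (here refl)                 (here refl)                 x≢y = ⊥-elim (x≢y refl)
  separation (there (here refl))         (there (here refl))         x≢y = ⊥-elim (x≢y refl)
  separation (there (there (here refl))) (there (there (here refl))) x≢y = ⊥-elim (x≢y refl)
  separation (here refl)                 (there (here refl))         _   = x₀-y₀
  separation (here refl)                 (there (there (here refl))) _   = x₀-z₀
  separation (there (here refl))         (there (there (here refl))) _   = y₀-z₀
  separation (there (here refl))         (here refl)                 _   = distinguished-sym H x₀-y₀
  separation (there (there (here refl))) (here refl)                 _   = distinguished-sym H x₀-z₀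
  separation (there (there (here refl))) (there (here refl))         _   = distinguished-sym H y₀-z₀
  separation (there (there (there ())))  _                           _
  separation _                           (there (there (there ())))  _

  basis-resolving : Resolving H basis
  basis-resolving =
    resolving-from-outsiders H (functigraph-K-distances f) basis outsiders cover separation

theorem3p4 : (n : ℕ) → 3 ≤ n → (f₀ : Fin n → Fin n) → IsConstant f₀ →
    MetricDim (Functigraph (K n) f₀) (2 * n ∸ 3)
theorem3p4 (suc (suc (suc m))) (s≤s (s≤s (s≤s z≤n))) f₀ f₀-const =
  (basis , basis-unique , basis-length , basis-resolving) , lower-bound
  where open ConstantFunctigraph m f₀ f₀-const
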